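{- Let $\mathcal{G}=(V,E)$ be a temporal graph, let $s,z\in V$, and let $x,\delta\in\mathbb{N}$. Fix one type of delay (starting delays, or traversal delays). If there is an $x$-delay-robust $(s,z)$-route (for delay time $\delta$ and this delay type), then there is an $x$-delay-robust $(s,z)$-route (for the same $\delta$ and delay type) in which no vertex is repeated.
   Context: A temporal graph $\mathcal{G}=(V,E)$ consists of a finite vertex set $V$ and a finite set $E$ of time arcs; a time arc $e=(v,w,t,\lambda)$ has start vertex $v$, end vertex $w$, time label $t\in\mathbb{N}$ and traversal time $\lambda\in\mathbb{N}$ (a connection from $v$ to $w$ departing at time $t$ and arriving at time $t+\lambda$). A temporal walk is a sequence of time arcs $(v_i,w_i,t_i,\lambda_i)_{i=1}^{\ell}$ with $v_{i+1}=w_i$ and $t_{i+1}\ge t_i+\lambda_i$ for all $i<\ell$. Given $\delta\in\mathbb{N}$ and a set $D\subseteq E$ of delayed arcs, a starting delay on an arc increases its time label by $\delta$, and a traversal delay increases its traversal time by $\delta$. A sequence of time arcs is a $D$-starting-delayed (resp. $D$-traversal-delayed) temporal walk if it is a temporal walk in the temporal graph obtained from $\mathcal{G}$ by applying starting (resp. traversal) delays of $\delta$ to all arcs in $D$. A route is a sequence of vertices $R$; a (delayed) temporal walk follows $R$ if the sequence of vertices it visits ($v_1,w_1,w_2,\dots,w_\ell$) is exactly $R$ in the given order; $R$ is a ($D$-delayed) route if some ($D$-delayed) temporal walk follows it. An $(s,z)$-route is a route starting at $s$ and ending at $z$. For $x\in\mathbb{N}$, a route is $x$-delay-robust (for the given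 delay type and $\delta$) if it is a $D$-delayed route for every $D\subseteq E$ with $|D|\le x$. -}

module Defs where

open import Data.Nat using (ℕ; _+_; _≤_)
open import Data.Fin using (Fin)
open import Data.Fin.Subset using (Subset; _∈_; ∣_∣)
open import Data.Fin.Subset.Properties using (_∈?_)
open import Data.List using (List; []; _∷_; _∷ʳ_)
open import Data.List.Relation.Unary.Unique.Propositional using (Unique)
open import Data.Product using (Σ; ∃; _×_)
open import Data.Unit using (⊤)
open import Data.Empty using (⊥)
open import Relation.Nullary using (yes; no)
open import Relation.Binary.PropositionalEquality using (_≡_)
open import Function.Definitions using (Injective)

record TimeArc (n : ℕ) : Set where
  constructor arc
  field
    start  : Fin n
    end    : Fin n
    label  : ℕ
    travel : ℕ
open TimeArc public

-- Arcs are addressed by their index in Fin m; `arcs` is required to be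
-- injective (see IsSet) so that E is a genuine set of time arcs.
record TemporalGraph : Set where
  field
    n    : ℕ
    m    : ℕ
    arcs : Fin m → TimeArc n
open TemporalGraph public

Vertex : TemporalGraph → Set
Vertex G = Fin (n G)

ArcIx : TemporalGraph → Set
ArcIx G = Fin (m G)

IsSet : TemporalGraph → Set
IsSet G = Injective _≡_ _≡_ (arcs G)

data DelayType : Set where
  starting traversal : DelayType

extra : ∀ {m} → ℕ → Subset m → Fin m → ℕ
extra δ D e with e ∈? D
... | yes _ = δ
... | no  _ = 0

dLabel : (G : TemporalGraph) → DelayType → ℕ → Subset (m G) → ArcIx G → ℕ
dLabel G starting  δ D e = label (arcs G e) + extra δ D e
dLabel G traversal δ D e = label (arcs G e)

dTravel : (G : TemporalGraph) → DelayType → ℕ → Subset (m G) → ArcIx G → ℕ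
dTravel G starting  δ D e = travel (arcs G e)
dTravel G traversal δ D e = travel (arcs G e) + extra δ D e

DelayedWalk : (G : TemporalGraph) → DelayType → ℕ → Subset (m G) → List (ArcIx G) → Set
DelayedWalk G ty δ D []           = ⊤
DelayedWalk G ty δ D (e ∷ [])     = ⊤
DelayedWalk G ty δ D (e ∷ f ∷ es) =
  (start (arcs G f) ≡ end (arcs G e)) ×
  (dLabel G ty δ D e + dTravel G ty δ D e ≤ dLabel G ty δ D f) ×
  DelayedWalk G ty δ D (f ∷ es)

-- The walk visits exactly the vertex sequence R = v₁, w₁, …, w_ℓ.
-- Convention: the empty walk follows every single-vertex route [v].
Follows : (G : TemporalGraph) → List (Vertex G) → List (ArcIx G) → Set
Follows G []            es       = ⊥
Follows G (v ∷ [])      []       = ⊤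
Follows G (v ∷ [])      (e ∷ es) = ⊥
Follows G (v ∷ w ∷ R)   []       = ⊥
Follows G (v ∷ w ∷ R)   (e ∷ es) =
  (start (arcs G e) ≡ v) × (end (arcs G e) ≡ w) × Follows G (w ∷ R) es

DelayedRoute : (G : TemporalGraph) → DelayType → ℕ → Subset (m G) → List (Vertex G) → Set
DelayedRoute G ty δ D R = ∃ λ (W : List (ArcIx G)) → DelayedWalk G ty δ D W × Follows G R W

Robust : (G : TemporalGraph) → DelayType → ℕ → ℕ → List (Vertex G) → Set
Robust G ty δ x R = (D : Subset (m G)) → ∣ D ∣ ≤ x → DelayedRoute G ty δ D R

IsSZ : (G : TemporalGraph) → Vertex G → Vertex G → List (Vertex G) → Set
IsSZ G s z R = (∃ λ ys → R ≡ s ∷ ys) × (∃ λ xs → R ≡ xs ∷ʳ z)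

-- Cut out the cycle between two occurrences of a repeated vertex v. Along any
-- D-delayed walk following the route, time never decreases, so the walk leaves
-- the last occurrence of v no earlier than it reaches the first one; gluing the
-- part before the first occurrence to the part after the last one therefore
-- gives a D-delayed walk along the shortened route. The shortening does not
-- depend on D, so robustness is preserved, and repeating it yields a route
-- without repeated vertices.
module Submission where

open import Defs
open import Data.Nat using (ℕ; _+_; _≤_; z≤n)
open import Data.Nat.Properties using (≤-trans; m≤m+n)
open import Data.Fin using () renaming (_≟_ to _≟ᶠ_)
open import Data.Fin.Subset using (Subset)
open import Data.List using (List; []; _∷_; _++_; _∷ʳ_)
open import Data.List.Properties using (∷-injectiveʳ)
open import Data.List.Relation.Unary.Unique.Propositional using (Unique)
open import Data.List.Relation.Unary.AllPairs using ([]; _∷_)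
open import Data.List.Relation.Unary.All using ([])
open import Data.List.Relation.Unary.All.Properties using (¬Any⇒All¬)
open import Data.List.Membership.Propositional.Properties using (∈-∃++)
open import Data.Product using (∃; Σ; _×_; _,_; proj₁)
open import Data.Unit using (⊤; tt)
open import Data.Empty using (⊥)
open import Relation.Nullary using (yes; no)
open import Relation.Binary.PropositionalEquality using (_≡_; refl; sym; trans; cong; subst)

HeadDropClosed : {X : Set} → (List X → Set) → Set
HeadDropClosed P = ∀ {a v C} → P (a ∷ v ∷ C) → P (v ∷ C)

suffix-closed : {X : Set} (P : List X → Set) → HeadDropClosed P →
  ∀ A {v C} → P (A ++ v ∷ C) → P (v ∷ C)
suffix-closed P drop []          p = p
suffix-closed P drop (a ∷ [])    p = drop p
suffix-closed P drop (a ∷ b ∷ A) p = suffix-closed P drop (b ∷ A) (drop p)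

EndsAt : {X : Set} → X → List X → Set
EndsAt z R = ∃ λ xs → R ≡ xs ∷ʳ z

endsAt-∷ : {X : Set} {z : X} (v : X) {R : List X} → EndsAt z R → EndsAt z (v ∷ R)
endsAt-∷ v (xs , eq) = v ∷ xs , cong (v ∷_) eq

endsAt-tail : {X : Set} {z : X} → HeadDropClosed (EndsAt z)
endsAt-tail ([]     , ())
endsAt-tail (_ ∷ xs , eq) = xs , ∷-injectiveʳ eq

unique-tail : {X : Set} → HeadDropClosed (Unique {A = X})
unique-tail (_ ∷ u) = u

follows-head : (G : TemporalGraph) {v : Vertex G} {R : List (Vertex G)} {f : ArcIx G} {W : List (ArcIx G)} →
  Follows G (v ∷ R) (f ∷ W) → start (arcs G f) ≡ v
follows-head G {R = _ ∷ _} fo = proj₁ fo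

module _ (G : TemporalGraph) (ty : DelayType) (δ : ℕ) (D : Subset (m G)) where

  arrival : ArcIx G → ℕ
  arrival e = dLabel G ty δ D e + dTravel G ty δ D e

  Feasible : ℕ → List (Vertex G) → Set
  Feasible t []          = ⊥
  Feasible t (v ∷ [])    = ⊤
  Feasible t (v ∷ w ∷ R) = Σ (ArcIx G) λ e →
    start (arcs G e) ≡ v × end (arcs G e) ≡ w × t ≤ dLabel G ty δ D e × Feasible (arrival e) (w ∷ R)

  feasible-weaken : ∀ {t t′} R → t′ ≤ t → Feasible t R → Feasible t′ R
  feasible-weaken (v ∷ [])    _    _                    = tt
  feasible-weaken (v ∷ w ∷ R) t′≤t (e , se , ee , t≤ , f) = e , se , ee , ≤-trans t′≤t t≤ , f

  feasible-tail : ∀ {t} → HeadDropClosed (Feasible t)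
  feasible-tail {C = C} (e , _ , _ , t≤ , f) = feasible-weaken (_ ∷ C) (≤-trans t≤ (m≤m+n _ _)) f

  DepartsAfter : ℕ → List (ArcIx G) → Set
  DepartsAfter t []      = ⊤
  DepartsAfter t (e ∷ _) = t ≤ dLabel G ty δ D e

  walk⇒feasible : ∀ {t} R W → DelayedWalk G ty δ D W → Follows G R W → DepartsAfter t W → Feasible t R
  walk⇒feasible (v ∷ [])    []           _              _             _  = tt
  walk⇒feasible (v ∷ w ∷ R) (e ∷ [])     _              (se , ee , fo) t≤ =
    e , se , ee , t≤ , walk⇒feasible (w ∷ R) [] tt fo tt
  walk⇒feasible (v ∷ w ∷ R) (e ∷ f ∷ W) (_ , ≤f , dw) (se , ee , fo) t≤ =
    e , se , ee , t≤ , walk⇒feasible (w ∷ R) (f ∷ W) dw fo ≤f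

  feasible⇒walk : ∀ {t} R → Feasible t R →
    ∃ λ W → DelayedWalk G ty δ D W × Follows G R W × DepartsAfter t W
  feasible⇒walk (v ∷ [])    _                      = [] , tt , tt , tt
  feasible⇒walk (v ∷ w ∷ R) (e , se , ee , t≤ , f) with feasible⇒walk (w ∷ R) f
  ... | []    , _  , fo , _  = e ∷ [] , tt , (se , ee , fo) , t≤
  ... | f ∷ W , dw , fo , ≤f = e ∷ f ∷ W , (trans (follows-head G fo) (sym ee) , ≤f , dw) , (se , ee , fo) , t≤

  delayedRoute⇒feasible : ∀ {R} → DelayedRoute G ty δ D R → Feasible 0 R
  delayedRoute⇒feasible {R} ([]    , dw , fo) = walk⇒feasible R [] dw fo tt
  delayedRoute⇒feasible {R} (e ∷ W , dw , fo) = walk⇒feasible R (e ∷ W) dw fo z≤n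

  feasible⇒delayedRoute : ∀ {t R} → Feasible t R → DelayedRoute G ty δ D R
  feasible⇒delayedRoute {R = R} f with feasible⇒walk R f
  ... | W , dw , fo , _ = W , dw , fo

module _ (G : TemporalGraph) where
  open import Data.List.Membership.DecPropositional (_≟ᶠ_ {n G}) using (_∈?_)

  removeCycles : (v : Vertex G) (R : List (Vertex G)) → ∃ λ R′ →
    Unique (v ∷ R′) ×
    (∀ {z} → EndsAt z (v ∷ R) → EndsAt z (v ∷ R′)) ×
    (∀ ty δ D t → Feasible G ty δ D t (v ∷ R) → Feasible G ty δ D t (v ∷ R′))
  removeCycles v []      = [] , ([] ∷ []) , (λ e → e) , (λ _ _ _ _ f → f)
  removeCycles v (w ∷ R) with removeCycles w R
  ... | R₁ , unique , ends , feasible with v ∈? (w ∷ R₁)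
  ...   | yes v∈ with ∈-∃++ v∈
  ...     | A , C , eq =
    C ,
    suffix-closed Unique unique-tail A (subst Unique eq unique) ,
    (λ e → suffix-closed (EndsAt _) endsAt-tail A (subst (EndsAt _) eq (ends (endsAt-tail e)))) ,
    λ ty δ D t f → suffix-closed (Feasible G ty δ D t) (feasible-tail G ty δ D) A
      (subst (Feasible G ty δ D t) eq (feasible ty δ D t (feasible-tail G ty δ D f)))
  removeCycles v (w ∷ R) | R₁ , unique , ends , feasible | no v∉ =
    w ∷ R₁ ,
    (¬Any⇒All¬ (w ∷ R₁) v∉ ∷ unique) ,
    (λ e → endsAt-∷ v (ends (endsAt-tail e))) ,
    λ { ty δ D t (e , se , ee , t≤ , f) → e , se , ee , t≤ , feasible ty δ D _ f }

lemma1 : (G : TemporalGraph) → IsSet G → (s z : Vertex G) → (x δ : ℕ) → (ty : DelayType) →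
    (∃ λ (R : List (Vertex G)) → IsSZ G s z R × Robust G ty δ x R) →
    ∃ λ (R : List (Vertex G)) → IsSZ G s z R × Robust G ty δ x R × Unique R
lemma1 G _ s z x δ ty (.(s ∷ R) , ((R , refl) , endsAtz) , robust) with removeCycles G s R
... | R′ , unique , ends , feasible = s ∷ R′ , ((R′ , refl) , ends endsAtz) , robust′ , unique
  where
    robust′ : Robust G ty δ x (s ∷ R′)
    robust′ D |D|≤x = feasible⇒delayedRoute G ty δ D
      (feasible ty δ D 0 (delayedRoute⇒feasible G ty δ D (robust D |D|≤x)))
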